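{- Let $q=p^r$ with $p$ prime, and $m\ge1,\ell\ge0$ integers. For $a\in\mathbb F_{q^m}^*$, $b\in\mathbb F_{q^m}$ and $0\le i\le r(m-1)$, let $\psi_{a,b,i}:\mathbb F_{q^m}\to\mathbb F_{q^m}$, $\psi_{a,b,i}(x)=ax^{p^i}+b$. Then $\psi_{a,b,i}$ is an automorphism of $\Gamma_{q,m}(\ell)$ if and only if $a\in S_{q,m}(\ell)$. In particular, $\{\psi_{a,b,i}: a\in S_{q,m}(\ell)\}$ is contained in $\mathrm{Aut}(\Gamma_{q,m}(\ell))$.
   Context: $S_{q,m}(\ell)=\{x^{q^\ell+1}:x\in\mathbb F_{q^m}^*\}$ and $\Gamma_{q,m}(\ell)$ is the Cayley (di)graph with vertex set $\mathbb F_{q^m}$ and an edge from $x$ to $y$ iff $y-x\in S_{q,m}(\ell)$. -}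

module Defs where

open import Level using (0ℓ)
open import Data.Nat using (ℕ; zero; suc; _^_)
open import Data.Fin using (Fin)
open import Data.Product using (Σ; ∃; _×_)
open import Relation.Binary.PropositionalEquality using (_≡_; _≢_)
open import Relation.Nullary using (¬_)
open import Algebra.Structures using (IsCommutativeRing)
open import Function.Bundles using (_↔_; _⇔_)
open import Function.Definitions using (Bijective)

record FiniteField (n : ℕ) : Set₁ where
  infixl 6 _+_ _-_
  infixl 7 _*_
  field
    Carrier : Set
    _+_ _*_ : Carrier → Carrier → Carrier
    -_      : Carrier → Carrier
    0# 1#   : Carrier
    isCommutativeRing : IsCommutativeRing _≡_ _+_ _*_ -_ 0# 1#
    0≢1     : 0# ≢ 1#
    inverse : ∀ x → x ≢ 0# → ∃ λ y → x * y ≡ 1#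
    enumeration : Carrier ↔ Fin n

  _-_ : Carrier → Carrier → Carrier
  x - y = x + (- y)

  pow : Carrier → ℕ → Carrier
  pow x zero    = 1#
  pow x (suc k) = x * pow x k

module _ {n : ℕ} (F : FiniteField n) where
  open FiniteField F

  InS : (q ℓ : ℕ) → Carrier → Set
  InS q ℓ a = ∃ λ x → x ≢ 0# × pow x (q ^ ℓ Data.Nat.+ 1) ≡ a

  ψ : (p : ℕ) → Carrier → Carrier → ℕ → Carrier → Carrier
  ψ p a b i x = a * pow x (p ^ i) + b

  -- Automorphism of the Cayley digraph Γ_{q,m}(ℓ): a bijection of the vertex set
  -- preserving and reflecting arcs (x → y iff y - x ∈ S).
  IsCayleyAut : (q ℓ : ℕ) → (Carrier → Carrier) → Set
  IsCayleyAut q ℓ f =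
    Bijective _≡_ _≡_ f ×
    (∀ x y → (InS q ℓ (y - x) → InS q ℓ (f y - f x)) × (InS q ℓ (f y - f x) → InS q ℓ (y - x)))

-- Counting the field shows |F| · 1 = 0, and since p^k · 1 = (p · 1)^k in a field, the characteristic
-- is p. The binomial theorem then makes φ(x) = x^(p^i) additive; having trivial kernel it is injective,
-- hence bijective on the finite field, and it commutes with the (q^ℓ+1)-th power map. Because
-- ψ(y) - ψ(x) = a · φ(y - x), ψ sends arcs to arcs (and non-arcs to non-arcs) exactly when multiplication
-- by a preserves the group S of nonzero (q^ℓ+1)-th powers, which holds for a ∈ S; conversely the arc
-- 0 → 1 is mapped to the arc ψ(0) → ψ(1), whose difference is a.
module Submission where

open import Level using (0ℓ)
open import Algebra.Bundles using (AbelianGroup; CommutativeRing)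
open import Algebra.Core using (Op₁; Op₂)
open import Algebra.Structures using (IsAbelianGroup)
open import Data.Empty using (⊥-elim)
open import Data.Fin as Fin using (Fin)
import Data.Fin.Properties as Fin
open import Data.Fin.Permutation using (Permutation; _⟨$⟩ʳ_)
open import Data.Nat as ℕ using (ℕ; zero; suc; _∸_; _<_; _≤_; _!)
import Data.Nat.Properties as ℕ
open import Data.Nat.Combinatorics using (_C_; nCn≡1; nCk≡nC[n∸k]; nCk≡n!/k![n-k]!; k![n∸k]!∣n!)
open import Data.Nat.Divisibility using (_∣_; _∤_; divides; ∣⇒≤; ∣1⇒≡1; m∣m*n)
open import Data.Nat.DivMod using (m/n*n≡m)
open import Data.Nat.Primality using (Prime; euclidsLemma; prime⇒nonTrivial; prime⇒nonZero)
open import Data.Product using (∃; _×_; _,_; proj₁; proj₂)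
open import Data.Sum using (inj₁; inj₂)
open import Function.Base using (_∘_)
open import Function.Bundles using (_↔_; _⇔_; Inverse; Injection; Equivalence; mk↔ₛ′; mk⇔)
open import Function.Consequences.Propositional using (strictlySurjective⇒surjective)
open import Function.Construct.Composition using (_↔-∘_; _⇔-∘_)
open import Function.Construct.Symmetry using (↔-sym)
open import Function.Definitions using (Injective; StrictlySurjective)
open import Function.Properties.Inverse using (↔⇒↣)
open import Relation.Binary.Definitions using (DecidableEquality)
open import Relation.Binary.PropositionalEquality as ≡
  using (_≡_; _≢_; refl; sym; trans; cong; cong₂; subst; module ≡-Reasoning)
open import Relation.Nullary using (yes; no)

open import Defs

prime∤! : ∀ {p k} → Prime p → k < p → p ∤ k !
prime∤! {k = zero} pp _ p∣1 = ℕ.nonTrivial⇒≢1 {{prime⇒nonTrivial pp}} (∣1⇒≡1 p∣1)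
prime∤! {k = suc k} pp k<p p∣k! with euclidsLemma (suc k) (k !) pp p∣k!
... | inj₁ p∣1+k = ℕ.<⇒≱ k<p (∣⇒≤ p∣1+k)
... | inj₂ p∣k!  = prime∤! pp (ℕ.<-trans (ℕ.n<1+n k) k<p) p∣k!

prime∣pCk : ∀ {p k} → Prime p → 0 < k → k < p → p ∣ p C k
prime∣pCk {p@(suc p-1)} {k} pp 0<k k<p
  with euclidsLemma (p C k) (k ! ℕ.* (p ∸ k) !) pp p∣pCk*denominator
  where
  instance _ = k ℕ.!* (p ∸ k) !≢0
  p∣pCk*denominator : p ∣ (p C k) ℕ.* (k ! ℕ.* (p ∸ k) !)
  p∣pCk*denominator = subst (p ∣_) (sym pCk*denominator≡p!) (m∣m*n (p-1 !))
    where
    k≤p = ℕ.<⇒≤ k<p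
    pCk*denominator≡p! : (p C k) ℕ.* (k ! ℕ.* (p ∸ k) !) ≡ p !
    pCk*denominator≡p! = trans (cong (ℕ._* (k ! ℕ.* (p ∸ k) !)) (nCk≡n!/k![n-k]! k≤p))
                               (m/n*n≡m (k![n∸k]!∣n! k≤p))
... | inj₁ p∣pCk = p∣pCk
... | inj₂ p∣denominator with euclidsLemma (k !) ((p ∸ k) !) pp p∣denominator
...   | inj₁ p∣k! = ⊥-elim (prime∤! pp k<p p∣k!)
...   | inj₂ p∣[p∸k]! = ⊥-elim (prime∤! pp (ℕ.∸-monoʳ-< 0<k (ℕ.<⇒≤ k<p)) p∣[p∸k]!)

Fin-injective⇒surjective : ∀ {n} {f : Fin n → Fin n} →
                           Injective _≡_ _≡_ f → StrictlySurjective _≡_ f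
Fin-injective⇒surjective {suc n} {f} f-injective y with Fin.any? (λ x → f x Fin.≟ y)
... | yes hit = hit
... | no miss = ⊥-elim (ℕ.<-irrefl refl (Fin.injective⇒≤ {f = avoid-y} avoid-y-injective))
  where
  avoid-y : Fin (suc n) → Fin n
  avoid-y x = Fin.punchOut {i = y} (λ y≡fx → miss (x , sym y≡fx))
  avoid-y-injective : Injective _≡_ _≡_ avoid-y
  avoid-y-injective = f-injective ∘ Fin.punchOut-injective {i = y} _ _

↔Fin-injective⇒surjective : ∀ {A : Set} {n} → A ↔ Fin n → {f : A → A} →
                            Injective _≡_ _≡_ f → StrictlySurjective _≡_ f
↔Fin-injective⇒surjective enum {f} f-injective y =
  let k , fk≡y = Fin-injective⇒surjective {f = to ∘ f ∘ from} conj-injective (to y)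
  in from k , to-injective fk≡y
  where
  open Inverse enum using (to; from)
  to-injective = Injection.injective (↔⇒↣ enum)
  from-injective = Injection.injective (↔⇒↣ (↔-sym enum))
  conj-injective : Injective _≡_ _≡_ (to ∘ f ∘ from)
  conj-injective = from-injective ∘ f-injective ∘ to-injective

module _ {A : Set} {_+_ : Op₂ A} {0# : A} { -_ : Op₁ A}
         (isAbelianGroup : IsAbelianGroup _≡_ _+_ 0# -_) where

  private
    G : AbelianGroup 0ℓ 0ℓ
    G = record { isAbelianGroup = isAbelianGroup }
  open AbelianGroup G using (commutativeMonoid; monoid; group; _-_; identityʳ)
  import Algebra.Properties.Monoid.Mult monoid as Mult
  open import Algebra.Properties.CommutativeMonoid.Sum commutativeMonoid
    using (sum; ∑-distrib-+; sum-replicate; sum-cong-≗; ∑-permute)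
  open import Algebra.Properties.Group group using (∙-cancelˡ; //-rightDividesˡ; //-rightDividesʳ)

  -- Translation by x permutes the elements, so their sum S satisfies S + N · x = S.
  card×x≡0 : ∀ {N} → A ↔ Fin N → ∀ x → N Mult.× x ≡ 0#
  card×x≡0 {N} enum x = ∙-cancelˡ S (N Mult.× x) 0# (begin
    S + (N Mult.× x)               ≡⟨ ≡.cong (S +_) (sum-replicate N) ⟨
    S + sum {N} (λ _ → x)          ≡⟨ ∑-distrib-+ from (λ _ → x) ⟨
    sum (λ k → from k + x)         ≡⟨ sum-cong-≗ (λ k → ≡.sym (strictlyInverseʳ (from k + x))) ⟩
    sum (from ∘ (translate ⟨$⟩ʳ_)) ≡⟨ ∑-permute from translate ⟨
    S                              ≡⟨ identityʳ S ⟨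
    S + 0#                         ∎)
    where
    open ≡.≡-Reasoning
    open Inverse enum using (to; from; strictlyInverseʳ)
    S = sum from
    translate : Permutation N N
    translate = enum ↔-∘ (mk↔ₛ′ (_+ x) (_- x) (//-rightDividesˡ x) (//-rightDividesʳ x) ↔-∘ ↔-sym enum)

module PrimeCharacteristic {c ℓ} (R : CommutativeRing c ℓ) where
  open CommutativeRing R
  import Algebra.Properties.Semiring.Mult semiring as Mult
  open Mult using (×-congʳ; ×-assoc-*; ×1-homo-*; ×-homo-1)
  open import Algebra.Properties.Semiring.Sum semiring using (sum; sum-init-last; sum-cong-≋; sum-replicate-zero)
  open import Algebra.Properties.CommutativeSemiring.Exp commutativeSemiring using (_^_; ^-assocʳ; ^-congˡ)
  open import Algebra.Properties.CommutativeSemiring.Binomial commutativeSemiring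
    using (theorem; binomialTerm)
  open import Relation.Binary.Reasoning.Setoid setoid

  char∣n⇒n×x≈0 : ∀ {p n} → p Mult.× 1# ≈ 0# → ∀ x → p ∣ n → n Mult.× x ≈ 0#
  char∣n⇒n×x≈0 {p} {n} char≡p x (divides q ≡.refl) = begin
    n Mult.× x                         ≈⟨ ×-congʳ n (*-identityˡ x) ⟨
    n Mult.× (1# * x)                  ≈⟨ ×-assoc-* n 1# x ⟨
    (n Mult.× 1#) * x                  ≈⟨ *-congʳ (×1-homo-* q p) ⟩
    (q Mult.× 1#) * (p Mult.× 1#) * x  ≈⟨ *-congʳ (*-congˡ char≡p) ⟩
    (q Mult.× 1#) * 0# * x             ≈⟨ *-congʳ (zeroʳ _) ⟩
    0# * x                             ≈⟨ zeroˡ x ⟩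
    0#                                 ∎

  binomialTerm-zero : ∀ x y n → binomialTerm x y n Fin.zero ≈ y ^ n
  binomialTerm-zero x y n = begin
    (n C 0) Mult.× (1# * y ^ n)  ≡⟨ ≡.cong (Mult._× (1# * y ^ n)) nC0≡1 ⟩
    1 Mult.× (1# * y ^ n)        ≈⟨ ×-homo-1 _ ⟩
    1# * y ^ n                   ≈⟨ *-identityˡ _ ⟩
    y ^ n                        ∎
    where
    nC0≡1 : n C 0 ≡ 1
    nC0≡1 = ≡.trans (nCk≡nC[n∸k] {k = 0} {n} ℕ.z≤n) (nCn≡1 n)

  binomialTerm-fromℕ : ∀ x y n → binomialTerm x y n (Fin.fromℕ n) ≈ x ^ n
  binomialTerm-fromℕ x y n rewrite Fin.toℕ-fromℕ n | nCn≡1 n | ℕ.n∸n≡0 n = begin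
    1 Mult.× (x ^ n * 1#)  ≈⟨ ×-homo-1 _ ⟩
    x ^ n * 1#             ≈⟨ *-identityʳ _ ⟩
    x ^ n                  ∎

  ^p-homo-+ : ∀ {p} → Prime p → p Mult.× 1# ≈ 0# → ∀ x y → (x + y) ^ p ≈ x ^ p + y ^ p
  ^p-homo-+ {zero} p-prime = ⊥-elim (ℕ.≢-nonZero⁻¹ 0 {{prime⇒nonZero p-prime}} ≡.refl)
  ^p-homo-+ {p@(suc p-1)} p-prime char≡p x y = begin
    (x + y) ^ p                                          ≈⟨ theorem p x y ⟩
    term Fin.zero + sum (λ k → term (Fin.suc k))         ≈⟨ +-congˡ (sum-init-last (λ k → term (Fin.suc k))) ⟩
    term Fin.zero + (sum inner + term (Fin.fromℕ p))     ≈⟨ +-congˡ (+-congʳ inner≈0) ⟩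
    term Fin.zero + (0# + term (Fin.fromℕ p))            ≈⟨ +-congˡ (+-identityˡ _) ⟩
    term Fin.zero + term (Fin.fromℕ p)                   ≈⟨ +-cong (binomialTerm-zero x y p) (binomialTerm-fromℕ x y p) ⟩
    y ^ p + x ^ p                                        ≈⟨ +-comm _ _ ⟩
    x ^ p + y ^ p                                        ∎
    where
    term = binomialTerm x y p
    inner : Fin p-1 → Carrier
    inner k = term (Fin.suc (Fin.inject₁ k))
    inner≈0 : sum inner ≈ 0#
    inner≈0 = begin
      sum inner               ≈⟨ sum-cong-≋ (λ k → char∣n⇒n×x≈0 char≡p _ (p∣inner-coefficient k)) ⟩
      sum {p-1} (λ _ → 0#)    ≈⟨ sum-replicate-zero p-1 ⟩
      0#                      ∎
      where
      p∣inner-coefficient : ∀ k → p ∣ p C suc (Fin.toℕ (Fin.inject₁ k))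
      p∣inner-coefficient k = prime∣pCk p-prime (ℕ.s≤s ℕ.z≤n) (ℕ.s≤s (Fin.inject₁ℕ< k))

  ^[p^i]-homo-+ : ∀ {p} → Prime p → p Mult.× 1# ≈ 0# →
                  ∀ i x y → (x + y) ^ (p ℕ.^ i) ≈ x ^ (p ℕ.^ i) + y ^ (p ℕ.^ i)
  ^[p^i]-homo-+ p-prime char≡p zero x y = distribʳ 1# x y
  ^[p^i]-homo-+ {p} p-prime char≡p (suc i) x y = begin
    (x + y) ^ (p ℕ.* q)         ≈⟨ ^-assocʳ (x + y) p q ⟨
    ((x + y) ^ p) ^ q           ≈⟨ ^-congˡ q (^p-homo-+ p-prime char≡p x y) ⟩
    (x ^ p + y ^ p) ^ q         ≈⟨ ^[p^i]-homo-+ p-prime char≡p i (x ^ p) (y ^ p) ⟩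
    (x ^ p) ^ q + (y ^ p) ^ q   ≈⟨ +-cong (^-assocʳ x p q) (^-assocʳ y p q) ⟩
    x ^ (p ℕ.* q) + y ^ (p ℕ.* q) ∎
    where q = p ℕ.^ i


module FiniteFieldProperties {N : ℕ} (F : FiniteField N) where
  open FiniteField F

  ring : CommutativeRing 0ℓ 0ℓ
  ring = record { isCommutativeRing = isCommutativeRing }

  open CommutativeRing ring
    using (+-isAbelianGroup; +-abelianGroup; +-group; +-commutativeSemigroup; +-identityʳ; -‿inverseʳ;
           *-comm; *-assoc; *-identityˡ; *-identityʳ; zeroʳ; semiring; commutativeSemiring)
  import Algebra.Properties.Semiring.Mult semiring as Mult
  open import Algebra.Properties.CommutativeSemiring.Exp commutativeSemiring using (_^_; ^-distrib-*; ^-assocʳ)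
  open import Algebra.Properties.Group +-group using (ε⁻¹≈ε; x∙y⁻¹≈ε⇒x≈y; x≈y⇒x∙y⁻¹≈ε; //-rightDividesˡ; //-rightDividesʳ)
  open import Algebra.Properties.AbelianGroup +-abelianGroup using (⁻¹-∙-comm)
  open import Algebra.Properties.CommutativeSemigroup +-commutativeSemigroup using (interchange)
  open import Algebra.Properties.Ring (CommutativeRing.ring ring) using (x[y-z]≈xy-xz; x+x≈x⇒x≈0)
  open PrimeCharacteristic ring using (^[p^i]-homo-+)
  open ≡-Reasoning

  _≟_ : DecidableEquality Carrier
  _≟_ = Fin.inj⇒≟ (↔⇒↣ enumeration)

  pow≗^ : ∀ x n → pow x n ≡ x ^ n
  pow≗^ x zero    = refl
  pow≗^ x (suc n) = cong (x *_) (pow≗^ x n)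

  pow-1# : ∀ n → pow 1# n ≡ 1#
  pow-1# zero    = refl
  pow-1# (suc n) = trans (*-identityˡ _) (pow-1# n)

  pow-distrib-* : ∀ x y n → pow (x * y) n ≡ pow x n * pow y n
  pow-distrib-* x y n = begin
    pow (x * y) n       ≡⟨ pow≗^ (x * y) n ⟩
    (x * y) ^ n         ≡⟨ ^-distrib-* x y n ⟩
    x ^ n * y ^ n       ≡⟨ cong₂ _*_ (pow≗^ x n) (pow≗^ y n) ⟨
    pow x n * pow y n   ∎

  pow-pow-comm : ∀ x m n → pow (pow x m) n ≡ pow (pow x n) m
  pow-pow-comm x m n = begin
    pow (pow x m) n     ≡⟨ trans (pow≗^ _ n) (cong (_^ n) (pow≗^ x m)) ⟩
    (x ^ m) ^ n         ≡⟨ ^-assocʳ x m n ⟩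
    x ^ (m ℕ.* n)       ≡⟨ cong (x ^_) (ℕ.*-comm m n) ⟩
    x ^ (n ℕ.* m)       ≡⟨ ^-assocʳ x n m ⟨
    (x ^ n) ^ m         ≡⟨ trans (pow≗^ _ m) (cong (_^ m) (pow≗^ x n)) ⟨
    pow (pow x n) m     ∎

  x≢0∧x*y≡0⇒y≡0 : ∀ {x y} → x ≢ 0# → x * y ≡ 0# → y ≡ 0#
  x≢0∧x*y≡0⇒y≡0 {x} {y} x≢0 xy≡0 = let x⁻¹ , xx⁻¹≡1 = inverse x x≢0 in begin
    y                   ≡⟨ *-identityˡ y ⟨
    1# * y              ≡⟨ cong (_* y) (trans (sym xx⁻¹≡1) (*-comm x x⁻¹)) ⟩
    (x⁻¹ * x) * y       ≡⟨ *-assoc x⁻¹ x y ⟩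
    x⁻¹ * (x * y)       ≡⟨ cong (x⁻¹ *_) xy≡0 ⟩
    x⁻¹ * 0#            ≡⟨ zeroʳ x⁻¹ ⟩
    0#                  ∎

  *-nonZero : ∀ {x y} → x ≢ 0# → y ≢ 0# → x * y ≢ 0#
  *-nonZero x≢0 y≢0 = y≢0 ∘ x≢0∧x*y≡0⇒y≡0 x≢0

  pow-nonZero : ∀ {x} n → x ≢ 0# → pow x n ≢ 0#
  pow-nonZero zero    x≢0 = 0≢1 ∘ sym
  pow-nonZero (suc n) x≢0 = *-nonZero x≢0 (pow-nonZero n x≢0)

  pow≡0⇒≡0 : ∀ {x} n → pow x n ≡ 0# → x ≡ 0#
  pow≡0⇒≡0 {x} n xⁿ≡0 with x ≟ 0#
  ... | yes x≡0 = x≡0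
  ... | no  x≢0 = ⊥-elim (pow-nonZero n x≢0 xⁿ≡0)

  [p^k]×1≡[p×1]^k : ∀ p k → (p ℕ.^ k) Mult.× 1# ≡ (p Mult.× 1#) ^ k
  [p^k]×1≡[p×1]^k p zero    = +-identityʳ 1#
  [p^k]×1≡[p×1]^k p (suc k) = trans (Mult.×1-homo-* p (p ℕ.^ k)) (cong (p Mult.× 1# *_) ([p^k]×1≡[p×1]^k p k))

  prime-power-order⇒char : ∀ {p} k → N ≡ p ℕ.^ k → p Mult.× 1# ≡ 0#
  prime-power-order⇒char {p} k N≡p^k = pow≡0⇒≡0 k (begin
    pow (p Mult.× 1#) k  ≡⟨ pow≗^ (p Mult.× 1#) k ⟩
    (p Mult.× 1#) ^ k    ≡⟨ [p^k]×1≡[p×1]^k p k ⟨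
    (p ℕ.^ k) Mult.× 1#  ≡⟨ cong (Mult._× 1#) N≡p^k ⟨
    N Mult.× 1#          ≡⟨ card×x≡0 +-isAbelianGroup enumeration 1# ⟩
    0#                   ∎)

  x-0≡x : ∀ x → x - 0# ≡ x
  x-0≡x x = trans (cong (x +_) ε⁻¹≈ε) (+-identityʳ x)

  [x+z]-[y+z]≡x-y : ∀ x y z → (x + z) - (y + z) ≡ x - y
  [x+z]-[y+z]≡x-y x y z = begin
    (x + z) + - (y + z)       ≡⟨ cong ((x + z) +_) (⁻¹-∙-comm y z) ⟨
    (x + z) + (- y + - z)     ≡⟨ interchange x z (- y) (- z) ⟩
    (x + - y) + (z + - z)     ≡⟨ cong ((x - y) +_) (-‿inverseʳ z) ⟩
    (x - y) + 0#              ≡⟨ +-identityʳ (x - y) ⟩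
    x - y                     ∎

  kernel-trivial⇒injective : (f g : Carrier → Carrier) → (∀ x y → f y - f x ≡ g (y - x)) →
                             (∀ z → g z ≡ 0# → z ≡ 0#) → Injective _≡_ _≡_ f
  kernel-trivial⇒injective f g f-diff g-kernel {x} {y} fx≡fy =
    sym (x∙y⁻¹≈ε⇒x≈y y x (g-kernel (y - x) (trans (sym (f-diff x y)) (x≈y⇒x∙y⁻¹≈ε (sym fx≡fy)))))

  additive⇒homo-- : (f : Carrier → Carrier) → (∀ x y → f (x + y) ≡ f x + f y) →
                    ∀ x y → f (y - x) ≡ f y - f x
  additive⇒homo-- f f-additive x y = begin
    f (y - x)                 ≡⟨ //-rightDividesʳ (f x) (f (y - x)) ⟨
    (f (y - x) + f x) - f x   ≡⟨ cong (_- f x) (f-additive (y - x) x) ⟨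
    f ((y - x) + x) - f x     ≡⟨ cong (λ z → f z - f x) (//-rightDividesˡ x y) ⟩
    f y - f x                 ∎

  -- InS F q ℓ is IsNonZeroPower (q ^ ℓ + 1) by definition.
  IsNonZeroPower : ℕ → Carrier → Set
  IsNonZeroPower K s = ∃ λ w → w ≢ 0# × pow w K ≡ s

  module _ (K : ℕ) where

    nonZeroPower-* : ∀ {s t} → IsNonZeroPower K s → IsNonZeroPower K t → IsNonZeroPower K (s * t)
    nonZeroPower-* (v , v≢0 , vᴷ≡s) (w , w≢0 , wᴷ≡t) =
      v * w , *-nonZero v≢0 w≢0 , trans (pow-distrib-* v w K) (cong₂ _*_ vᴷ≡s wᴷ≡t)

    nonZeroPower-cancelˡ : ∀ {a s} → IsNonZeroPower K a → IsNonZeroPower K (a * s) → IsNonZeroPower K s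
    nonZeroPower-cancelˡ {a} {s} (z , z≢0 , zᴷ≡a) as-power =
      subst (IsNonZeroPower K) z⁻ᴷ*as≡s (nonZeroPower-* (z⁻¹ , z⁻¹≢0 , refl) as-power)
      where
      z⁻¹ = proj₁ (inverse z z≢0)
      zz⁻¹≡1 = proj₂ (inverse z z≢0)
      z⁻¹≢0 : z⁻¹ ≢ 0#
      z⁻¹≢0 z⁻¹≡0 = 0≢1 (trans (sym (trans (cong (z *_) z⁻¹≡0) (zeroʳ z))) zz⁻¹≡1)
      z⁻ᴷ*as≡s : pow z⁻¹ K * (a * s) ≡ s
      z⁻ᴷ*as≡s = begin
        pow z⁻¹ K * (a * s)           ≡⟨ cong (λ u → pow z⁻¹ K * (u * s)) zᴷ≡a ⟨
        pow z⁻¹ K * (pow z K * s)     ≡⟨ *-assoc _ _ s ⟨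
        (pow z⁻¹ K * pow z K) * s     ≡⟨ cong (_* s) (pow-distrib-* z⁻¹ z K) ⟨
        pow (z⁻¹ * z) K * s           ≡⟨ cong (λ u → pow u K * s) (trans (*-comm z⁻¹ z) zz⁻¹≡1) ⟩
        pow 1# K * s                  ≡⟨ cong (_* s) (pow-1# K) ⟩
        1# * s                        ≡⟨ *-identityˡ s ⟩
        s                             ∎

    nonZeroPower-*⇔ : ∀ {a s} → IsNonZeroPower K a → IsNonZeroPower K (a * s) ⇔ IsNonZeroPower K s
    nonZeroPower-*⇔ a-power = mk⇔ (nonZeroPower-cancelˡ a-power) (nonZeroPower-* a-power)

    nonZeroPower-image⇔ : (f : Carrier → Carrier) → Injective _≡_ _≡_ f → StrictlySurjective _≡_ f →
                          f 0# ≡ 0# → (∀ w → f (pow w K) ≡ pow (f w) K) →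
                          ∀ s → IsNonZeroPower K (f s) ⇔ IsNonZeroPower K s
    nonZeroPower-image⇔ f f-injective f-surjective f0≡0 f-pow s = mk⇔ reflect preserve
      where
      preserve : IsNonZeroPower K s → IsNonZeroPower K (f s)
      preserve (w , w≢0 , wᴷ≡s) =
        f w , (λ fw≡0 → w≢0 (f-injective (trans fw≡0 (sym f0≡0)))) , trans (sym (f-pow w)) (cong f wᴷ≡s)
      reflect : IsNonZeroPower K (f s) → IsNonZeroPower K s
      reflect (w , w≢0 , wᴷ≡fs) = let u , fu≡w = f-surjective w in
        u , (λ u≡0 → w≢0 (trans (sym fu≡w) (trans (cong f u≡0) f0≡0))) ,
        f-injective (trans (f-pow u) (trans (cong (λ v → pow v K) fu≡w) wᴷ≡fs))

  IsCayleyAut⇒InS[f1-f0] : ∀ q ℓ f → IsCayleyAut F q ℓ f → InS F q ℓ (f 1# - f 0#)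
  IsCayleyAut⇒InS[f1-f0] q ℓ f (_ , arcs) =
    proj₁ (arcs 0# 1#) (1# , 0≢1 ∘ sym , trans (pow-1# (q ℕ.^ ℓ ℕ.+ 1)) (sym (x-0≡x 1#)))

  injective∧arc⇔⇒IsCayleyAut : ∀ q ℓ f → Injective _≡_ _≡_ f →
                               (∀ x y → InS F q ℓ (f y - f x) ⇔ InS F q ℓ (y - x)) → IsCayleyAut F q ℓ f
  injective∧arc⇔⇒IsCayleyAut q ℓ f f-injective arc⇔ =
    (f-injective , strictlySurjective⇒surjective (↔Fin-injective⇒surjective enumeration f-injective)) ,
    λ x y → Equivalence.from (arc⇔ x y) , Equivalence.to (arc⇔ x y)

  module Frobenius {p} (p-prime : Prime p) (char≡p : p Mult.× 1# ≡ 0#) where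

    frob : ℕ → Carrier → Carrier
    frob i x = pow x (p ℕ.^ i)

    frob-homo-+ : ∀ i x y → frob i (x + y) ≡ frob i x + frob i y
    frob-homo-+ i x y = begin
      pow (x + y) q       ≡⟨ pow≗^ (x + y) q ⟩
      (x + y) ^ q         ≡⟨ ^[p^i]-homo-+ p-prime char≡p i x y ⟩
      x ^ q + y ^ q       ≡⟨ cong₂ _+_ (pow≗^ x q) (pow≗^ y q) ⟨
      pow x q + pow y q   ∎
      where q = p ℕ.^ i

    frob-homo-- : ∀ i x y → frob i (y - x) ≡ frob i y - frob i x
    frob-homo-- i = additive⇒homo-- (frob i) (frob-homo-+ i)

    frob-0# : ∀ i → frob i 0# ≡ 0#
    frob-0# i = x+x≈x⇒x≈0 (frob i 0#) (trans (sym (frob-homo-+ i 0# 0#)) (cong (frob i) (+-identityʳ 0#)))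

    frob-injective : ∀ i → Injective _≡_ _≡_ (frob i)
    frob-injective i = kernel-trivial⇒injective (frob i) (frob i) (λ x y → sym (frob-homo-- i x y))
                                                (λ _ → pow≡0⇒≡0 (p ℕ.^ i))

    ψ-diff : ∀ a b i x y → ψ F p a b i y - ψ F p a b i x ≡ a * frob i (y - x)
    ψ-diff a b i x y = begin
      (a * frob i y + b) - (a * frob i x + b)   ≡⟨ [x+z]-[y+z]≡x-y _ _ b ⟩
      a * frob i y - a * frob i x               ≡⟨ x[y-z]≈xy-xz a _ _ ⟨
      a * (frob i y - frob i x)                 ≡⟨ cong (a *_) (frob-homo-- i x y) ⟨
      a * frob i (y - x)                        ∎

    ψ-injective : ∀ {a} b i → a ≢ 0# → Injective _≡_ _≡_ (ψ F p a b i)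
    ψ-injective b i a≢0 = kernel-trivial⇒injective _ _ (ψ-diff _ b i)
      (λ _ → pow≡0⇒≡0 (p ℕ.^ i) ∘ x≢0∧x*y≡0⇒y≡0 a≢0)

    frob-nonZeroPower⇔ : ∀ K i s → IsNonZeroPower K (frob i s) ⇔ IsNonZeroPower K s
    frob-nonZeroPower⇔ K i = nonZeroPower-image⇔ K (frob i) (frob-injective i)
      (↔Fin-injective⇒surjective enumeration (frob-injective i)) (frob-0# i) (λ w → pow-pow-comm w K (p ℕ.^ i))

    ψ-arc⇔ : ∀ K {a} b i → IsNonZeroPower K a →
             ∀ x y → IsNonZeroPower K (ψ F p a b i y - ψ F p a b i x) ⇔ IsNonZeroPower K (y - x)
    ψ-arc⇔ K {a} b i a-power x y =
      frob-nonZeroPower⇔ K i (y - x) ⇔-∘ (nonZeroPower-*⇔ K a-power ⇔-∘ by-ψ-diff)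
      where
      by-ψ-diff : IsNonZeroPower K (ψ F p a b i y - ψ F p a b i x) ⇔ IsNonZeroPower K (a * frob i (y - x))
      by-ψ-diff = mk⇔ (subst (IsNonZeroPower K) (ψ-diff a b i x y)) (subst (IsNonZeroPower K) (sym (ψ-diff a b i x y)))

    ψ-IsCayleyAut⇒InS : ∀ q ℓ {a} b i → IsCayleyAut F q ℓ (ψ F p a b i) → InS F q ℓ a
    ψ-IsCayleyAut⇒InS q ℓ {a} b i ψ-aut =
      subst (InS F q ℓ) (trans (ψ-diff a b i 0# 1#) a*frob[1-0]≡a) (IsCayleyAut⇒InS[f1-f0] q ℓ _ ψ-aut)
      where
      a*frob[1-0]≡a : a * frob i (1# - 0#) ≡ a
      a*frob[1-0]≡a = begin
        a * frob i (1# - 0#)  ≡⟨ cong (λ z → a * frob i z) (x-0≡x 1#) ⟩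
        a * frob i 1#         ≡⟨ cong (a *_) (pow-1# (p ℕ.^ i)) ⟩
        a * 1#                ≡⟨ *-identityʳ a ⟩
        a                     ∎

    InS⇒ψ-IsCayleyAut : ∀ q ℓ {a} b i → a ≢ 0# → InS F q ℓ a → IsCayleyAut F q ℓ (ψ F p a b i)
    InS⇒ψ-IsCayleyAut q ℓ b i a≢0 a∈S =
      injective∧arc⇔⇒IsCayleyAut q ℓ _ (ψ-injective b i a≢0) (ψ-arc⇔ (q ℕ.^ ℓ ℕ.+ 1) b i a∈S)

-- Opened only now, since in the modules above _^_ and _*_ are the field operations.
open import Data.Nat using (_^_; _*_)

lemma6p1 : (p r m ℓ : ℕ) → Prime p → 1 ≤ r → 1 ≤ m →
    (F : FiniteField ((p ^ r) ^ m)) →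
    (a b : FiniteField.Carrier F) → a ≢ FiniteField.0# F →
    (i : ℕ) → i ≤ r * (m ∸ 1) →
    (IsCayleyAut F (p ^ r) ℓ (ψ F p a b i) → InS F (p ^ r) ℓ a) ×
    (InS F (p ^ r) ℓ a → IsCayleyAut F (p ^ r) ℓ (ψ F p a b i))
lemma6p1 p r m ℓ p-prime _ _ F a b a≢0 i _ =
  ψ-IsCayleyAut⇒InS (p ^ r) ℓ b i , InS⇒ψ-IsCayleyAut (p ^ r) ℓ b i a≢0
  where
  open FiniteFieldProperties F
  open Frobenius p-prime (prime-power-order⇒char (r * m) (ℕ.^-*-assoc p r m))
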